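{- Let $\mathcal{P}$ be a relational predicate language, $\mathcal{L}$ a signature with $\{\lor,\land\}\subseteq\mathcal{L}$, and $\psi$ an existential-$\land$-positive sentence. Then $\mathrm{Mod}_{fin}(\psi)$ is closed under protomorphisms: if $(A,F,M)$ and $(B,G,N)$ are finite $\mathcal{P}$-models over interpreting lattices in signature $\mathcal{L}$, $(A,F,M)\models\psi$ and $(A,F,M)\rightarrow_p(B,G,N)$, then $(B,G,N)\models\psi$.
   Context: An interpreting lattice is a pair $(A,F)$ where $A$ is an algebra in a signature $\mathcal{L}\supseteq\{\lor,\land\}$ such that $\langle A,\land,\lor\rangle$ is a lattice and $F\subseteq A$ satisfies: $a\land b\in F$ iff ($a\in F$ and $b\in F$), and $a\lor b\in F$ iff ($a\in F$ or $b\in F$). A $\mathcal{P}$-model $(A,F,M)$ consists of an interpreting lattice $(A,F)$, a nonempty set $M$ and maps $R^M:M^n\to A$, with truth values of formulas defined by $R^M$ on atoms, operations of $A$ on connectives, and infimum/supremum in $A$ over $M$ for $\forall/\exists$ (all existing); finite if $M$ is finite. $(A,F,M)\models\phi$ iff $\|\phi\|^M\in F$. A protomorphism from $(A,F,M)$ to $(B,G,N)$ is a map $g:M\to N$ such that $R^M(\bar m)\in F$ implies $R^N(g(\bar m))\in G$ for all $R\in\mathcal{P}$ and tuples $\bar m$; written $\rightarrow_p$. A $\land$-primitive sentence has the form $\exists\bar x\bigwedge_{i=1}^nR_i(\bar x_i)$; an existential-$\land$-positive sentence is a finite disjunction of these. $\mathrm{Mod}_{fin}(\psi)$ is the class of finite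 $\mathcal{P}$-models over interpreting lattices in signature $\mathcal{L}$ satisfying $\psi$. -}

module Defs where

open import Data.Nat using (ℕ; zero; suc)
open import Data.Fin using (Fin; zero; suc)
open import Data.Vec using (Vec; []; _∷_; lookup; map)
open import Data.List.NonEmpty using (List⁺; foldr₁) renaming (map to map⁺)
open import Data.Product using (Σ; _×_; ∃)
open import Data.Sum using (_⊎_)
open import Function using (Surjective)
open import Function.Bundles using (_⇔_)
open import Relation.Binary.PropositionalEquality using (_≡_)
open import Algebra.Lattice.Structures using (IsLattice)

record Language : Set₁ where
  field
    Pred  : Set
    arity : Pred → ℕ

-- A signature ℒ ⊇ {∨,∧}: the binary symbols ∨, ∧ plus further
-- operation symbols `Extra` with arities.
record Signature : Set₁ where
  field
    Extra  : Set
    arityE : Extra → ℕ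

record LatticeAlgebra (L : Signature) : Set₁ where
  open Signature L
  infixr 7 _∧_
  infixr 6 _∨_
  field
    Carrier   : Set
    _∨_ _∧_   : Carrier → Carrier → Carrier
    op        : (o : Extra) → Vec Carrier (arityE o) → Carrier
    isLattice : IsLattice _≡_ _∨_ _∧_

record InterpretingLattice (L : Signature) : Set₁ where
  field
    alg : LatticeAlgebra L
  open LatticeAlgebra alg public
  field
    F      : Carrier → Set
    F-∧    : ∀ a b → F (a ∧ b) ⇔ (F a × F b)
    F-∨    : ∀ a b → F (a ∨ b) ⇔ (F a ⊎ F b)

-- Finite 𝒫-model (A , F , M) over an interpreting lattice in signature ℒ.
-- M is finite and nonempty: it is the surjective image of Fin (suc size).
record FinModel (P : Language) (L : Signature) : Set₁ where
  open Language P
  field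
    lat  : InterpretingLattice L
  open InterpretingLattice lat public
  field
    M        : Set
    size     : ℕ
    enum     : Fin (suc size) → M
    enum-surj : Surjective _≡_ _≡_ enum
    R        : (r : Pred) → Vec M (arity r) → Carrier

  ⋁Fin : ∀ {n} → (Fin (suc n) → Carrier) → Carrier
  ⋁Fin {zero}  f = f zero
  ⋁Fin {suc n} f = f zero ∨ ⋁Fin (λ i → f (suc i))

  supM : (M → Carrier) → Carrier
  supM f = ⋁Fin (λ i → f (enum i))

  -- ‖∃x₁…∃x_k φ‖ = sup_{m₁} … sup_{m_k} ‖φ‖[m̄]
  supTuple : (k : ℕ) → (Vec M k → Carrier) → Carrier
  supTuple zero    f = f []
  supTuple (suc k) f = supM (λ m → supTuple k (λ v → f (m ∷ v)))

record Atom (P : Language) (k : ℕ) : Set where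
  open Language P
  field
    pred : Pred
    args : Vec (Fin k) (arity pred)

record PrimSentence (P : Language) : Set where
  field
    nvars : ℕ
    atoms : List⁺ (Atom P nvars)

-- existential-∧-positive sentence: a (nonempty) finite disjunction.
ExPosSentence : Language → Set
ExPosSentence P = List⁺ (PrimSentence P)

module _ {P : Language} {L : Signature} (𝔐 : FinModel P L) where
  open FinModel 𝔐

  atomVal : ∀ {k} → Vec M k → Atom P k → Carrier
  atomVal ρ a = R (Atom.pred a) (map (lookup ρ) (Atom.args a))

  primVal : PrimSentence P → Carrier
  primVal φ = supTuple (PrimSentence.nvars φ)
    (λ ρ → foldr₁ _∧_ (map⁺ (atomVal ρ) (PrimSentence.atoms φ)))

  ‖_‖ : ExPosSentence P → Carrier
  ‖ ψ ‖ = foldr₁ _∨_ (map⁺ primVal ψ)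

  _⊨_ : ExPosSentence P → Set
  _⊨_ ψ = F ‖ ψ ‖

Protomorphism : {P : Language} {L : Signature} → FinModel P L → FinModel P L → Set
Protomorphism {P} 𝔐 𝔑 =
  Σ (FinModel.M 𝔐 → FinModel.M 𝔑) λ g →
    ∀ (r : Language.Pred P) (ms : Vec (FinModel.M 𝔐) (Language.arity P r)) →
      FinModel.F 𝔐 (FinModel.R 𝔐 r ms) → FinModel.F 𝔑 (FinModel.R 𝔑 r (map g ms))

-- F behaves like a prime filter: a finite join lies in F iff one of its terms does, a finite
-- meet iff all of them do. Over a finite M the quantifier ∃ is a finite join too, so a finite
-- model satisfies ∃x̄ ⋀ᵢ Rᵢ(x̄ᵢ) iff some assignment ρ puts every Rᵢ(ρ x̄ᵢ) in F. A
-- protomorphism g turns such a ρ into the assignment g ∘ ρ for the same disjunct of ψ.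
module Submission where

open import Defs
open import Data.Nat using (zero; suc)
open import Data.Fin using (Fin; zero; suc)
open import Data.Vec using (Vec; []; _∷_; lookup; map)
open import Data.Vec.Properties using (map-∘; map-cong; lookup-map)
open import Data.List using ([]; _∷_)
open import Data.List.NonEmpty using (_∷_; toList; foldr₁)
open import Data.List.Relation.Unary.Any using (Any; here; there)
import Data.List.Relation.Unary.Any as Any
import Data.List.Relation.Unary.Any.Properties as Any
open import Data.List.Relation.Unary.All using (All; []; _∷_)
import Data.List.Relation.Unary.All as All
import Data.List.Relation.Unary.All.Properties as All
open import Data.Product using (Σ; ∃; _,_)
open import Data.Sum using (inj₁; inj₂)
open import Function using (_∘_)
open import Function.Bundles using (Equivalence)
open import Relation.Binary.PropositionalEquality using (_≡_; refl; sym; trans; subst)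

open Equivalence using (to; from)

module PrimeFilter {L : Signature} (I : InterpretingLattice L) where
  open InterpretingLattice I

  F-foldr₁-∨⁻ : ∀ x xs → F (foldr₁ _∨_ (x ∷ xs)) → Any F (x ∷ xs)
  F-foldr₁-∨⁻ x []       p = here p
  F-foldr₁-∨⁻ x (y ∷ ys) p with to (F-∨ _ _) p
  ... | inj₁ q = here q
  ... | inj₂ q = there (F-foldr₁-∨⁻ y ys q)

  F-foldr₁-∨⁺ : ∀ x xs → Any F (x ∷ xs) → F (foldr₁ _∨_ (x ∷ xs))
  F-foldr₁-∨⁺ x []       (here p)  = p
  F-foldr₁-∨⁺ x (y ∷ ys) (here p)  = from (F-∨ _ _) (inj₁ p)
  F-foldr₁-∨⁺ x (y ∷ ys) (there p) = from (F-∨ _ _) (inj₂ (F-foldr₁-∨⁺ y ys p))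

  F-foldr₁-∧⁻ : ∀ x xs → F (foldr₁ _∧_ (x ∷ xs)) → All F (x ∷ xs)
  F-foldr₁-∧⁻ x []       p = p ∷ []
  F-foldr₁-∧⁻ x (y ∷ ys) p with to (F-∧ _ _) p
  ... | q , r = q ∷ F-foldr₁-∧⁻ y ys r

  F-foldr₁-∧⁺ : ∀ x xs → All F (x ∷ xs) → F (foldr₁ _∧_ (x ∷ xs))
  F-foldr₁-∧⁺ x []       (p ∷ [])  = p
  F-foldr₁-∧⁺ x (y ∷ ys) (p ∷ ps) = from (F-∧ _ _) (p , F-foldr₁-∧⁺ y ys ps)

module Semantics {P : Language} {L : Signature} (𝔐 : FinModel P L) where
  open FinModel 𝔐
  open PrimeFilter lat

  F-⋁Fin⁻ : ∀ {n} (f : Fin (suc n) → Carrier) → F (⋁Fin f) → ∃ λ i → F (f i)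
  F-⋁Fin⁻ {zero}  f p = zero , p
  F-⋁Fin⁻ {suc n} f p with to (F-∨ _ _) p
  ... | inj₁ q = zero , q
  ... | inj₂ q with F-⋁Fin⁻ (f ∘ suc) q
  ...   | i , r = suc i , r

  F-⋁Fin⁺ : ∀ {n} (f : Fin (suc n) → Carrier) (i : Fin (suc n)) →
    F (f i) → F (⋁Fin f)
  F-⋁Fin⁺ {zero}  f zero    p = p
  F-⋁Fin⁺ {suc n} f zero    p = from (F-∨ _ _) (inj₁ p)
  F-⋁Fin⁺ {suc n} f (suc i) p = from (F-∨ _ _) (inj₂ (F-⋁Fin⁺ (f ∘ suc) i p))

  F-supM⁻ : (f : M → Carrier) → F (supM f) → ∃ λ m → F (f m)
  F-supM⁻ f p with F-⋁Fin⁻ (f ∘ enum) p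
  ... | i , q = enum i , q

  F-supM⁺ : (f : M → Carrier) (m : M) → F (f m) → F (supM f)
  F-supM⁺ f m p with enum-surj m
  ... | i , enum-i≡m = F-⋁Fin⁺ (f ∘ enum) i (subst (F ∘ f) (sym (enum-i≡m refl)) p)

  F-supTuple⁻ : ∀ k (f : Vec M k → Carrier) → F (supTuple k f) → ∃ λ ρ → F (f ρ)
  F-supTuple⁻ zero    f p = [] , p
  F-supTuple⁻ (suc k) f p with F-supM⁻ _ p
  ... | m , q with F-supTuple⁻ k (f ∘ (m ∷_)) q
  ...   | ρ , r = m ∷ ρ , r

  F-supTuple⁺ : ∀ k (f : Vec M k → Carrier) (ρ : Vec M k) →
    F (f ρ) → F (supTuple k f)
  F-supTuple⁺ zero    f []      p = p
  F-supTuple⁺ (suc k) f (m ∷ ρ) p = F-supM⁺ _ m (F-supTuple⁺ k (f ∘ (m ∷_)) ρ p)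

  SatisfyingAssignment : PrimSentence P → Set
  SatisfyingAssignment φ =
    Σ (Vec M (PrimSentence.nvars φ)) λ ρ → All (F ∘ atomVal 𝔐 ρ) (toList (PrimSentence.atoms φ))

  ⊨-prim⁻ : ∀ φ → F (primVal 𝔐 φ) → SatisfyingAssignment φ
  ⊨-prim⁻ record { nvars = k ; atoms = a ∷ as } p with F-supTuple⁻ k _ p
  ... | ρ , q = ρ , All.map⁻ (F-foldr₁-∧⁻ _ _ q)

  ⊨-prim⁺ : ∀ φ → SatisfyingAssignment φ → F (primVal 𝔐 φ)
  ⊨-prim⁺ record { nvars = k ; atoms = a ∷ as } (ρ , q) =
    F-supTuple⁺ k _ ρ (F-foldr₁-∧⁺ _ _ (All.map⁺ q))

  ⊨⁻ : ∀ ψ → 𝔐 ⊨ ψ → Any (F ∘ primVal 𝔐) (toList ψ)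
  ⊨⁻ (φ ∷ φs) = Any.map⁻ ∘ F-foldr₁-∨⁻ _ _

  ⊨⁺ : ∀ ψ → Any (F ∘ primVal 𝔐) (toList ψ) → 𝔐 ⊨ ψ
  ⊨⁺ (φ ∷ φs) = F-foldr₁-∨⁺ _ _ ∘ Any.map⁺

map-lookup-map : ∀ {A B : Set} {k n} (g : A → B) (ρ : Vec A k) (is : Vec (Fin k) n) →
  map g (map (lookup ρ) is) ≡ map (lookup (map g ρ)) is
map-lookup-map g ρ is =
  trans (sym (map-∘ g (lookup ρ) is)) (map-cong (λ i → sym (lookup-map i g ρ)) is)

module Preservation {P : Language} {L : Signature} (𝔐 𝔑 : FinModel P L)
                    (protomorphism : Protomorphism 𝔐 𝔑) where
  module 𝔐 = FinModel 𝔐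
  module 𝔑 = FinModel 𝔑
  open Σ protomorphism renaming (proj₁ to g; proj₂ to g-preserves)

  atomVal-preserved : ∀ {k} (ρ : Vec 𝔐.M k) (a : Atom P k) →
    𝔐.F (atomVal 𝔐 ρ a) → 𝔑.F (atomVal 𝔑 (map g ρ) a)
  atomVal-preserved ρ a p =
    subst (𝔑.F ∘ 𝔑.R (Atom.pred a)) (map-lookup-map g ρ (Atom.args a))
      (g-preserves (Atom.pred a) _ p)

  primVal-preserved : ∀ φ → 𝔐.F (primVal 𝔐 φ) → 𝔑.F (primVal 𝔑 φ)
  primVal-preserved φ p with Semantics.⊨-prim⁻ 𝔐 φ p
  ... | ρ , q = Semantics.⊨-prim⁺ 𝔑 φ (map g ρ , All.map (atomVal-preserved ρ _) q)

mainTheorem7 : (P : Language) (L : Signature) (ψ : ExPosSentence P)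
    (𝔐 𝔑 : FinModel P L) →
    _⊨_ 𝔐 ψ → Protomorphism 𝔐 𝔑 → _⊨_ 𝔑 ψ
mainTheorem7 P L ψ 𝔐 𝔑 𝔐⊨ψ 𝔐→ₚ𝔑 =
  Semantics.⊨⁺ 𝔑 ψ (Any.map (λ {φ} → primVal-preserved φ) (Semantics.⊨⁻ 𝔐 ψ 𝔐⊨ψ))
  where open Preservation 𝔐 𝔑 𝔐→ₚ𝔑
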